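{- Let $n\geq 1$ and $k\geq 3$ be integers, let $k_1,\ldots,k_{2n+1}$ be positive integers, and let $G$ be the clique expansion $C_{2n+1}[k_1,\ldots,k_{2n+1}]$. Then $G$ is $k$-colorable if and only if both of the following hold, where indices are taken modulo $2n+1$: (i) $k_i+k_{i+1}\leq k$ for every $i\in\{1,\ldots,2n+1\}$; (ii) $\sum_{i=1}^{2n+1} k_i\leq nk$.
   Context: For $p\geq 3$ and positive integers $k_1,\ldots,k_p$, the clique expansion $C_p[k_1,\ldots,k_p]$ is the graph obtained from the cycle $C_p$ with vertices $v_1,\ldots,v_p$ (in cyclic order) by replacing each $v_i$ with a complete graph $K^i$ on $k_i$ vertices, where two vertices in distinct cliques $K^i,K^j$ are adjacent if and only if $v_iv_j$ is an edge of the cycle (i.e. $j\equiv i\pm1 \pmod p$), in which case all edges between $K^i$ and $K^j$ are present. A graph is $k$-colorable if its vertices can be colored with $k$ colors so that adjacent vertices receive distinct colors. -}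

module Defs where

open import Data.Nat using (ℕ; zero; suc; _+_; _*_; _%_; _≤_; NonZero)
open import Data.Fin using (Fin; toℕ; zero; suc; fromℕ<)
open import Data.Nat.DivMod using (m%n<n)
open import Data.Product using (Σ; _×_; proj₁; proj₂)
open import Data.Sum using (_⊎_)
open import Relation.Binary.PropositionalEquality using (_≡_)
open import Relation.Nullary using (¬_)

sumFin : (p : ℕ) → (Fin p → ℕ) → ℕ
sumFin zero    f = 0
sumFin (suc p) f = f zero + sumFin p (λ i → f (suc i))

nextIdx : (p : ℕ) .{{_ : NonZero p}} → Fin p → Fin p
nextIdx p i = fromℕ< (m%n<n (suc (toℕ i)) p)

CycleAdj : (p : ℕ) .{{_ : NonZero p}} → Fin p → Fin p → Set
CycleAdj p i j = (nextIdx p i ≡ j) ⊎ (nextIdx p j ≡ i)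

-- Vertices of the clique expansion C_p[k_0,…,k_{p-1}]:
-- pairs (i , a) with a a vertex of the clique K^i on k i vertices.
CEVertex : (p : ℕ) → (Fin p → ℕ) → Set
CEVertex p k = Σ (Fin p) (λ i → Fin (k i))

CEAdj : (p : ℕ) .{{_ : NonZero p}} (k : Fin p → ℕ) →
        CEVertex p k → CEVertex p k → Set
CEAdj p k u v = ¬ (u ≡ v) × ((proj₁ u ≡ proj₁ v) ⊎ CycleAdj p (proj₁ u) (proj₁ v))

ProperColoring : (p : ℕ) .{{_ : NonZero p}} (k : Fin p → ℕ) (c : ℕ) →
                 (CEVertex p k → Fin c) → Set
ProperColoring p k c col = ∀ u v → CEAdj p k u v → ¬ (col u ≡ col v)

CEColorable : (p : ℕ) .{{_ : NonZero p}} (k : Fin p → ℕ) (c : ℕ) → Set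
CEColorable p k c = Σ (CEVertex p k → Fin c) (ProperColoring p k c)

module Submission where

-- Necessity: a colour occurs at most once in each clique and never in two adjacent cliques,
-- so the cliques using it form an independent set of C_{2n+1}, of size at most n. Counting
-- clique–colour incidences gives Σ k_i ≤ n k, and two adjacent cliques alone need k_i + k_{i+1}
-- colours.
--
-- Sufficiency: lay clique t out on the line as the window [s_t, s_t + k_t) and colour the point
-- x by x mod k. It suffices that each window starts after its predecessor ends and ends before
-- the predecessor's window shifted by one period k begins, also for the wrap-around edge. Pack
-- the cliques end to end, inserting before clique t+1 a gap taken greedily from the slack
-- k − k_t − k_{t+1}, until the excess n k − Σ k_i is used up. The total slack covers the excess,
-- so the last clique ends exactly at n k, and then the first clique, shifted by n − 1 periods,
-- fits just below it.

open import Defs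
open import Data.Fin using (Fin; zero; suc; toℕ; fromℕ; inject₁; punchIn)
open import Data.Fin.Properties
  using (toℕ-fromℕ<; toℕ-fromℕ; toℕ-inject₁; toℕ<n; toℕ-injective; any?; ¬Fin0)
  renaming (_≟_ to _≟ᶠ_; suc-injective to suc-injectiveᶠ; 0≢1+n to 0≢1+nᶠ)
open import Data.Nat using (ℕ; zero; suc; _+_; _*_; _∸_; _⊓_; _%_; _/_; _≤_; _<_; z≤n; s≤s; s≤s⁻¹; NonZero)
open import Data.Nat.DivMod using (_mod_; m<n⇒m%n≡m; n%n≡0; m≡m%n+[m/n]*n; [m+kn]%n≡m%n)
open import Data.Nat.Properties
open import Algebra.Properties.CommutativeMonoid.Sum +-0-commutativeMonoid
  using (sum; sum-syntax; sum-remove; sum-init-last; sum-cong-≗; ∑-distrib-+; ∑-comm)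
open import Data.Nat.Tactic.RingSolver using (solve)
open import Data.List using (_∷_; [])
open import Data.Product using (_×_; _,_; proj₁; ∃)
open import Data.Sum using (_⊎_; inj₁; inj₂)
open import Function using (_∘_; Injective)
open import Function.Bundles using (_⇔_; mk⇔)
open import Relation.Nullary using (¬_; Dec; yes; no; contradiction)
open import Relation.Binary.PropositionalEquality
open import Relation.Binary.Definitions using (tri<; tri≈; tri>)
open import Algebra.Properties.CommutativeSemigroup +-commutativeSemigroup using (xy∙z≈xz∙y; xy∙z≈zx∙y)

sumFin≡sum : ∀ p (f : Fin p → ℕ) → sumFin p f ≡ sum f
sumFin≡sum zero    f = refl
sumFin≡sum (suc p) f = cong (f zero +_) (sumFin≡sum p (f ∘ suc))

∑-const : ∀ p c → ∑[ i < p ] c ≡ p * c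
∑-const zero    c = refl
∑-const (suc p) c = cong (c +_) (∑-const p c)

∑-mono-≤ : ∀ {p} {f g : Fin p → ℕ} → (∀ i → f i ≤ g i) → sum f ≤ sum g
∑-mono-≤ {zero}  f≤g = z≤n
∑-mono-≤ {suc p} f≤g = +-mono-≤ (f≤g zero) (∑-mono-≤ (f≤g ∘ suc))

∑-mono-< : ∀ {p} {f g : Fin (suc p) → ℕ} (i : Fin (suc p)) →
           (∀ j → f j ≤ g j) → f i < g i → sum f < sum g
∑-mono-< {p} {f} {g} i f≤g fi<gi = begin-strict
  sum f                        ≡⟨ sum-remove f ⟩
  f i + ∑[ j < p ] f (punchIn i j) <⟨ +-mono-<-≤ fi<gi (∑-mono-≤ (f≤g ∘ punchIn i)) ⟩
  g i + ∑[ j < p ] g (punchIn i j) ≡⟨ sum-remove g ⟨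
  sum g                        ∎
  where open ≤-Reasoning

∑-toℕ-snoc : ∀ t (g : ℕ → ℕ) → ∑[ j < suc t ] g (toℕ j) ≡ ∑[ j < t ] g (toℕ j) + g t
∑-toℕ-snoc t g = trans (sum-init-last {t} (g ∘ toℕ))
  (cong₂ _+_ (sum-cong-≗ {t} (cong g ∘ toℕ-inject₁)) (cong g (toℕ-fromℕ t)))

∑-toℕ-≤-snoc : ∀ t (g : ℕ → ℕ) → ∑[ j < t ] g (toℕ j) ≤ ∑[ j < suc t ] g (toℕ j)
∑-toℕ-≤-snoc t g = ≤-trans (m≤m+n _ (g t)) (≤-reflexive (sym (∑-toℕ-snoc t g)))

toℕ-nextIdx : ∀ m (i : Fin (suc m)) → toℕ (nextIdx (suc m) i) ≡ suc (toℕ i) % suc m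
toℕ-nextIdx m i = toℕ-fromℕ< _

nextIdx-inject₁ : ∀ m (j : Fin m) → nextIdx (suc m) (inject₁ j) ≡ suc j
nextIdx-inject₁ m j = toℕ-injective (begin
  toℕ (nextIdx (suc m) (inject₁ j)) ≡⟨ toℕ-nextIdx m (inject₁ j) ⟩
  suc (toℕ (inject₁ j)) % suc m     ≡⟨ cong (λ x → suc x % suc m) (toℕ-inject₁ j) ⟩
  suc (toℕ j) % suc m               ≡⟨ m<n⇒m%n≡m (s≤s (toℕ<n j)) ⟩
  suc (toℕ j)                       ∎)
  where open ≡-Reasoning

nextIdx-fromℕ : ∀ m → nextIdx (suc m) (fromℕ m) ≡ zero
nextIdx-fromℕ m = toℕ-injective (begin
  toℕ (nextIdx (suc m) (fromℕ m)) ≡⟨ toℕ-nextIdx m (fromℕ m) ⟩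
  suc (toℕ (fromℕ m)) % suc m     ≡⟨ cong (λ x → suc x % suc m) (toℕ-fromℕ m) ⟩
  suc m % suc m                   ≡⟨ n%n≡0 (suc m) ⟩
  0                               ∎)
  where open ≡-Reasoning

toℕ-nextIdx-cases : ∀ m (i : Fin (suc m)) →
  (toℕ i < m × toℕ (nextIdx (suc m) i) ≡ suc (toℕ i)) ⊎ (toℕ i ≡ m × toℕ (nextIdx (suc m) i) ≡ 0)
toℕ-nextIdx-cases m i with m≤n⇒m<n∨m≡n (s≤s⁻¹ (toℕ<n i))
... | inj₁ i<m = inj₁ (i<m , trans (toℕ-nextIdx m i) (m<n⇒m%n≡m (s≤s i<m)))
... | inj₂ i≡m = inj₂ (i≡m , trans (toℕ-nextIdx m i) (trans (cong (λ x → suc x % suc m) i≡m) (n%n≡0 (suc m))))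

nextIdx-≢ : ∀ m (i : Fin (suc (suc m))) → i ≢ nextIdx (suc (suc m)) i
nextIdx-≢ m i i≡next with toℕ-nextIdx-cases (suc m) i
... | inj₁ (_ , next≡) = 1+n≢n (sym (trans (cong toℕ i≡next) next≡))
... | inj₂ (i≡ , next≡) = 1+n≢0 (trans (sym i≡) (trans (cong toℕ i≡next) next≡))

∑-rotate : ∀ m (g : Fin (suc m) → ℕ) → sum (g ∘ nextIdx (suc m)) ≡ sum g
∑-rotate m g = begin
  sum (g ∘ nextIdx (suc m))
    ≡⟨ sum-init-last (g ∘ nextIdx (suc m)) ⟩
  ∑[ j < m ] g (nextIdx (suc m) (inject₁ j)) + g (nextIdx (suc m) (fromℕ m))
    ≡⟨ cong₂ _+_ (sum-cong-≗ (cong g ∘ nextIdx-inject₁ m)) (cong g (nextIdx-fromℕ m)) ⟩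
  ∑[ j < m ] g (suc j) + g zero
    ≡⟨ +-comm _ (g zero) ⟩
  sum g
    ∎
  where open ≡-Reasoning

∑-cyclic-pairs : ∀ m (b : Fin (suc m) → ℕ) → ∑[ i < suc m ] (b i + b (nextIdx (suc m) i)) ≡ sum b + sum b
∑-cyclic-pairs m b = trans (∑-distrib-+ b (b ∘ nextIdx (suc m))) (cong (sum b +_) (∑-rotate m b))

odd-cycle-independent : ∀ n (b : Fin (suc (2 * n)) → ℕ) →
  (∀ i → b i + b (nextIdx (suc (2 * n)) i) ≤ 1) → sum b ≤ n
odd-cycle-independent n b independent = s≤s⁻¹ (*-cancelˡ-< 2 (sum b) (suc n) (begin-strict
  2 * sum b                                          ≡⟨ cong (sum b +_) (+-identityʳ (sum b)) ⟩
  sum b + sum b                                      ≡⟨ ∑-cyclic-pairs (2 * n) b ⟨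
  ∑[ i < suc (2 * n) ] (b i + b (nextIdx (suc (2 * n)) i)) ≤⟨ ∑-mono-≤ independent ⟩
  ∑[ i < suc (2 * n) ] 1                             ≡⟨ trans (∑-const (suc (2 * n)) 1) (*-identityʳ _) ⟩
  suc (2 * n)                                        <⟨ n<1+n _ ⟩
  suc (suc (2 * n))                                  ≡⟨ solve (n ∷ []) ⟩
  2 * suc n                                          ∎))
  where open ≤-Reasoning

indicator : {P : Set} → Dec P → ℕ
indicator (yes _) = 1
indicator (no _)  = 0

indicator-mono : {P Q : Set} → (P → Q) → (p? : Dec P) (q? : Dec Q) → indicator p? ≤ indicator q?
indicator-mono P⇒Q (yes p) (yes _) = ≤-refl
indicator-mono P⇒Q (yes p) (no ¬q) = contradiction (P⇒Q p) ¬q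
indicator-mono P⇒Q (no _)  _       = z≤n

indicator-< : {P Q : Set} → ¬ P → Q → (p? : Dec P) (q? : Dec Q) → indicator p? < indicator q?
indicator-< ¬p q (yes p) _      = contradiction p ¬p
indicator-< ¬p q (no _) (yes _) = ≤-refl
indicator-< ¬p q (no _) (no ¬q) = contradiction q ¬q

inImage? : ∀ {m k} (f : Fin m → Fin k) (c : Fin k) → Dec (∃ λ a → f a ≡ c)
inImage? f c = any? λ a → f a ≟ᶠ c

inImage : ∀ {m k} → (Fin m → Fin k) → Fin k → ℕ
inImage f c = indicator (inImage? f c)

injective⇒≤-∑-inImage : ∀ {m k} (f : Fin m → Fin k) → Injective _≡_ _≡_ f → m ≤ sum (inImage f)
injective⇒≤-∑-inImage {zero}          f f-inj = z≤n
injective⇒≤-∑-inImage {suc m} {zero}  f f-inj = contradiction (f zero) ¬Fin0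
injective⇒≤-∑-inImage {suc m} {suc k} f f-inj = ≤-<-trans
  (injective⇒≤-∑-inImage (f ∘ suc) (suc-injectiveᶠ ∘ f-inj))
  (∑-mono-< (f zero)
    (λ c → indicator-mono (λ { (a , fa≡c) → suc a , fa≡c }) (inImage? (f ∘ suc) c) (inImage? f c))
    (indicator-< (λ { (a , fa≡f0) → 0≢1+nᶠ (f-inj (sym fa≡f0)) }) (zero , refl)
                 (inImage? (f ∘ suc) (f zero)) (inImage? f (f zero))))

module Necessity {p} .{{_ : NonZero p}} (loopless : ∀ i → i ≢ nextIdx p i)
  {ks : Fin p → ℕ} {k : ℕ} (colour : CEVertex p ks → Fin k) (proper : ProperColoring p ks k colour) where

  open ≤-Reasoning

  colour-injective-on-clique : ∀ i → Injective _≡_ _≡_ (λ a → colour (i , a))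
  colour-injective-on-clique i {a} {b} ca≡cb with a ≟ᶠ b
  ... | yes a≡b = a≡b
  ... | no  a≢b = contradiction ca≡cb (proper (i , a) (i , b) ((λ { refl → a≢b refl }) , inj₁ refl))

  colour-≢-on-adjacent-cliques : ∀ i a b → colour (i , a) ≢ colour (nextIdx p i , b)
  colour-≢-on-adjacent-cliques i a b =
    proper (i , a) (nextIdx p i , b) (loopless i ∘ cong proj₁ , inj₂ (inj₁ refl))

  uses : Fin p → Fin k → ℕ
  uses i = inImage (λ a → colour (i , a))

  clique-size≤∑uses : ∀ i → ks i ≤ sum (uses i)
  clique-size≤∑uses i = injective⇒≤-∑-inImage _ (colour-injective-on-clique i)

  uses-adjacent-≤1 : ∀ i c → uses i c + uses (nextIdx p i) c ≤ 1
  uses-adjacent-≤1 i c with inImage? (λ a → colour (i , a)) c | inImage? (λ b → colour (nextIdx p i , b)) c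
  ... | yes (a , ca≡c) | yes (b , cb≡c) =
          contradiction (trans ca≡c (sym cb≡c)) (colour-≢-on-adjacent-cliques i a b)
  ... | yes _ | no _  = ≤-refl
  ... | no _  | yes _ = ≤-refl
  ... | no _  | no _  = z≤n

  adjacent-clique-sizes-≤ : ∀ i → ks i + ks (nextIdx p i) ≤ k
  adjacent-clique-sizes-≤ i = begin
    ks i + ks (nextIdx p i)                         ≤⟨ +-mono-≤ (clique-size≤∑uses i) (clique-size≤∑uses (nextIdx p i)) ⟩
    sum (uses i) + sum (uses (nextIdx p i))         ≡⟨ ∑-distrib-+ (uses i) (uses (nextIdx p i)) ⟨
    ∑[ c < k ] (uses i c + uses (nextIdx p i) c)    ≤⟨ ∑-mono-≤ (uses-adjacent-≤1 i) ⟩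
    ∑[ c < k ] 1                                    ≡⟨ trans (∑-const k 1) (*-identityʳ k) ⟩
    k                                               ∎

  -- α bounds the independence number of C_p: the cliques using a given colour are independent.
  clique-sizes-∑-≤ : ∀ α → (∀ b → (∀ i → b i + b (nextIdx p i) ≤ 1) → sum b ≤ α) → sum ks ≤ α * k
  clique-sizes-∑-≤ α independent≤α = begin
    sum ks                         ≤⟨ ∑-mono-≤ clique-size≤∑uses ⟩
    ∑[ i < p ] ∑[ c < k ] uses i c ≡⟨ ∑-comm uses ⟩
    ∑[ c < k ] ∑[ i < p ] uses i c ≤⟨ ∑-mono-≤ (λ c → independent≤α (λ i → uses i c) (λ i → uses-adjacent-≤1 i c)) ⟩
    ∑[ c < k ] α                   ≡⟨ trans (∑-const k α) (*-comm k α) ⟩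
    α * k                          ∎

%-≢-within-period : ∀ k .{{_ : NonZero k}} {x y} → x < y → y < x + k → x % k ≢ y % k
%-≢-within-period k {x} {y} x<y y<x+k x%k≡y%k = <⇒≱ y<x+k (begin
    x + k                   ≡⟨ cong (_+ k) (m≡m%n+[m/n]*n x k) ⟩
    x % k + x / k * k + k   ≡⟨ +-assoc (x % k) _ k ⟩
    x % k + (x / k * k + k) ≡⟨ cong (x % k +_) (+-comm _ k) ⟩
    x % k + suc (x / k) * k ≤⟨ +-monoʳ-≤ (x % k) (*-monoˡ-≤ k x/k<y/k) ⟩
    x % k + y / k * k       ≡⟨ cong (_+ y / k * k) x%k≡y%k ⟩
    y % k + y / k * k       ≡⟨ m≡m%n+[m/n]*n y k ⟨
    y                       ∎)
  where
    open ≤-Reasoning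
    x/k<y/k : x / k < y / k
    x/k<y/k = *-cancelʳ-< k _ _ (+-cancelˡ-< (x % k) _ _ (begin-strict
      x % k + x / k * k ≡⟨ m≡m%n+[m/n]*n x k ⟨
      x                 <⟨ x<y ⟩
      y                 ≡⟨ m≡m%n+[m/n]*n y k ⟩
      y % k + y / k * k ≡⟨ cong (_+ y / k * k) x%k≡y%k ⟨
      x % k + y / k * k ∎))

+-%-≢ : ∀ k .{{_ : NonZero k}} u {a b} → a < b → b < k → (u + a) % k ≢ (u + b) % k
+-%-≢ k u {a} a<b b<k = %-≢-within-period k (+-monoʳ-< u a<b)
  (≤-trans (+-monoʳ-< u b<k) (+-monoˡ-≤ k (m≤m+n u a)))

+-%-injective : ∀ k .{{_ : NonZero k}} u {a b} → a < k → b < k → (u + a) % k ≡ (u + b) % k → a ≡ b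
+-%-injective k u {a} {b} a<k b<k ua≡ub with <-cmp a b
... | tri< a<b _ _ = contradiction ua≡ub (+-%-≢ k u a<b b<k)
... | tri≈ _ a≡b _ = a≡b
... | tri> _ _ b<a = contradiction (sym ua≡ub) (+-%-≢ k u b<a a<k)

windows-%-disjoint : ∀ k .{{_ : NonZero k}} {u l v m a b} → u + l ≤ v → v + m ≤ u + k →
  a < l → b < m → (u + a) % k ≢ (v + b) % k
windows-%-disjoint k {u} {l} {v} {m} {a} {b} u+l≤v v+m≤u+k a<l b<m = %-≢-within-period k
  (begin-strict u + a <⟨ +-monoʳ-< u a<l ⟩ u + l ≤⟨ u+l≤v ⟩ v ≤⟨ m≤m+n v b ⟩ v + b ∎)
  (begin-strict v + b <⟨ +-monoʳ-< v b<m ⟩ v + m ≤⟨ v+m≤u+k ⟩ u + k ≤⟨ +-monoˡ-≤ k (m≤m+n u a) ⟩ u + a + k ∎)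
  where open ≤-Reasoning

module Placement (n k : ℕ) (w : ℕ → ℕ)
  (adjacent : ∀ t → t < 2 * n → w t + w (suc t) ≤ k)
  (total : ∑[ t < suc (2 * n) ] w (toℕ t) ≤ n * k) where

  widthSum : ℕ → ℕ
  widthSum t = ∑[ j < t ] w (toℕ j)

  slack : ℕ → ℕ
  slack t = k ∸ (w t + w (suc t))

  slackSum : ℕ → ℕ
  slackSum t = ∑[ j < t ] slack (toℕ j)

  excess : ℕ
  excess = n * k ∸ widthSum (suc (2 * n))

  gap : ℕ → ℕ
  gap t = slackSum t ⊓ excess

  position : ℕ → ℕ
  position t = widthSum t + gap t

  widthSum-suc : ∀ t → widthSum (suc t) ≡ widthSum t + w t
  widthSum-suc t = ∑-toℕ-snoc t w

  slackSum-suc : ∀ t → slackSum (suc t) ≡ slackSum t + slack t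
  slackSum-suc t = ∑-toℕ-snoc t slack

  gap-suc≤ : ∀ t → gap (suc t) ≤ gap t + slack t
  gap-suc≤ t = begin
    slackSum (suc t) ⊓ excess               ≡⟨ cong (_⊓ excess) (slackSum-suc t) ⟩
    (slackSum t + slack t) ⊓ excess         ≤⟨ ⊓-monoʳ-≤ (slackSum t + slack t) (m≤m+n excess (slack t)) ⟩
    (slackSum t + slack t) ⊓ (excess + slack t) ≡⟨ +-distribʳ-⊓ (slack t) (slackSum t) excess ⟨
    gap t + slack t                         ∎
    where open ≤-Reasoning

  position+w≤position-suc : ∀ t → position t + w t ≤ position (suc t)
  position+w≤position-suc t = begin
    widthSum t + gap t + w t   ≡⟨ xy∙z≈xz∙y (widthSum t) (gap t) (w t) ⟩
    widthSum t + w t + gap t   ≡⟨ cong (_+ gap t) (widthSum-suc t) ⟨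
    widthSum (suc t) + gap t   ≤⟨ +-monoʳ-≤ (widthSum (suc t)) (⊓-monoˡ-≤ excess (∑-toℕ-≤-snoc t slack)) ⟩
    position (suc t)           ∎
    where open ≤-Reasoning

  position-suc+w≤position+k : ∀ t → t < 2 * n → position (suc t) + w (suc t) ≤ position t + k
  position-suc+w≤position+k t t<2n = begin
    widthSum (suc t) + gap (suc t) + w (suc t)
      ≡⟨ cong (λ x → x + gap (suc t) + w (suc t)) (widthSum-suc t) ⟩
    widthSum t + w t + gap (suc t) + w (suc t)
      ≤⟨ +-monoˡ-≤ (w (suc t)) (+-monoʳ-≤ (widthSum t + w t) (gap-suc≤ t)) ⟩
    widthSum t + w t + (gap t + slack t) + w (suc t)
      ≡⟨ regroup (widthSum t) (w t) (gap t) (slack t) (w (suc t)) ⟩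
    position t + (slack t + (w t + w (suc t)))
      ≡⟨ cong (position t +_) (m∸n+n≡m (adjacent t t<2n)) ⟩
    position t + k
      ∎
    where
      open ≤-Reasoning
      regroup : ∀ a b c d e → a + b + (c + d) + e ≡ a + c + (d + (b + e))
      regroup a b c d e = solve (a ∷ b ∷ c ∷ d ∷ e ∷ [])

  slack-balance : ∀ t → t ≤ 2 * n → slackSum t + widthSum t + widthSum (suc t) ≡ t * k + w 0
  slack-balance zero    _    = +-identityʳ (w 0)
  slack-balance (suc t) t<2n = begin
    slackSum (suc t) + widthSum (suc t) + widthSum (suc (suc t))
      ≡⟨ cong₂ (λ x y → x + widthSum (suc t) + y) (slackSum-suc t) (widthSum-suc (suc t)) ⟩
    slackSum t + slack t + widthSum (suc t) + (widthSum (suc t) + w (suc t))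
      ≡⟨ cong (λ x → slackSum t + slack t + x + (widthSum (suc t) + w (suc t))) (widthSum-suc t) ⟩
    slackSum t + slack t + (widthSum t + w t) + (widthSum (suc t) + w (suc t))
      ≡⟨ regroup (slackSum t) (slack t) (widthSum t) (w t) (widthSum (suc t)) (w (suc t)) ⟩
    slackSum t + widthSum t + widthSum (suc t) + (slack t + (w t + w (suc t)))
      ≡⟨ cong₂ _+_ (slack-balance t (≤-trans (n≤1+n t) t<2n)) (m∸n+n≡m (adjacent t t<2n)) ⟩
    t * k + w 0 + k
      ≡⟨ xy∙z≈zx∙y (t * k) (w 0) k ⟩
    suc t * k + w 0
      ∎
    where
      open ≡-Reasoning
      regroup : ∀ a b c d e f → a + b + (c + d) + (e + f) ≡ a + c + e + (b + (d + f))
      regroup a b c d e f = solve (a ∷ b ∷ c ∷ d ∷ e ∷ f ∷ [])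

  excess≤slackSum : excess ≤ slackSum (2 * n)
  excess≤slackSum = m≤n+o⇒m∸n≤o (n * k) (widthSum (suc (2 * n))) (+-cancelʳ-≤ (n * k) (n * k) _ (begin
    n * k + n * k                                               ≤⟨ m≤m+n _ (w 0) ⟩
    n * k + n * k + w 0                                         ≡⟨ cong (_+ w 0) (double (n * k)) ⟩
    2 * (n * k) + w 0                                           ≡⟨ cong (_+ w 0) (*-assoc 2 n k) ⟨
    2 * n * k + w 0                                             ≡⟨ slack-balance (2 * n) ≤-refl ⟨
    slackSum (2 * n) + widthSum (2 * n) + widthSum (suc (2 * n))
      ≤⟨ +-mono-≤ (+-monoʳ-≤ (slackSum (2 * n)) (∑-toℕ-≤-snoc (2 * n) w)) total ⟩
    slackSum (2 * n) + widthSum (suc (2 * n)) + n * k           ≡⟨ cong (_+ n * k) (+-comm (slackSum (2 * n)) _) ⟩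
    widthSum (suc (2 * n)) + slackSum (2 * n) + n * k           ∎))
    where
      open ≤-Reasoning
      double : ∀ a → a + a ≡ 2 * a
      double a = cong (a +_) (sym (+-identityʳ a))

  position-last+w≡n*k : position (2 * n) + w (2 * n) ≡ n * k
  position-last+w≡n*k = begin
    widthSum (2 * n) + gap (2 * n) + w (2 * n) ≡⟨ xy∙z≈xz∙y (widthSum (2 * n)) (gap (2 * n)) (w (2 * n)) ⟩
    widthSum (2 * n) + w (2 * n) + gap (2 * n) ≡⟨ cong (_+ gap (2 * n)) (widthSum-suc (2 * n)) ⟨
    widthSum (suc (2 * n)) + gap (2 * n)       ≡⟨ cong (widthSum (suc (2 * n)) +_) (m≥n⇒m⊓n≡n excess≤slackSum) ⟩
    widthSum (suc (2 * n)) + excess            ≡⟨ m+[n∸m]≡n total ⟩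
    n * k                                      ∎
    where open ≡-Reasoning

module Sufficiency (n′ : ℕ) {k : ℕ} .{{_ : NonZero k}} {ks : Fin (suc (2 * suc n′)) → ℕ}
  (adjacent : ∀ i → ks i + ks (nextIdx (suc (2 * suc n′)) i) ≤ k)
  (total : sum ks ≤ suc n′ * k) where

  n N p : ℕ
  n = suc n′
  N = 2 * n
  p = suc N

  toℕ-mod : ∀ {t} → t < p → toℕ (t mod p) ≡ t
  toℕ-mod t<p = trans (toℕ-fromℕ< _) (m<n⇒m%n≡m t<p)

  w : ℕ → ℕ
  w t = ks (t mod p)

  w-toℕ : ∀ i → w (toℕ i) ≡ ks i
  w-toℕ i = cong ks (toℕ-injective (toℕ-mod (toℕ<n i)))

  w-adjacent : ∀ t → t ≤ N → w t + w (suc t) ≤ k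
  w-adjacent t t≤N = subst (λ x → w t + ks (suc x mod p) ≤ k) (toℕ-mod (s≤s t≤N)) (adjacent (t mod p))

  w-p≡w-0 : w p ≡ w 0
  w-p≡w-0 = cong ks (toℕ-injective (trans (toℕ-fromℕ< _) (n%n≡0 p)))

  open Placement n k w (λ t t<N → w-adjacent t (<⇒≤ t<N))
    (subst (_≤ n * k) (sum-cong-≗ (sym ∘ w-toℕ)) total)

  consecutive-windows : ∀ t → t < N → ∀ {a b} → a < w t → b < w (suc t) →
    (position t + a) % k ≢ (position (suc t) + b) % k
  consecutive-windows t t<N =
    windows-%-disjoint k (position+w≤position-suc t) (position-suc+w≤position+k t t<N)

  wrap-windows : ∀ {a b} → a < w N → b < w 0 → (position N + a) % k ≢ (position 0 + b) % k
  wrap-windows {a} {b} a<wN b<w0 ≡% = windows-%-disjoint k {u = n′ * k} {v = position N}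
    n′k+w0≤position-N position-N+w≤n′k+k b<w0 a<wN (trans shift-by-periods (sym ≡%))
    where
      open ≤-Reasoning
      shift-by-periods : (n′ * k + b) % k ≡ b % k
      shift-by-periods = trans (cong (_% k) (+-comm (n′ * k) b)) ([m+kn]%n≡m%n b n′ k)
      position-N+w≤n′k+k : position N + w N ≤ n′ * k + k
      position-N+w≤n′k+k = ≤-reflexive (trans position-last+w≡n*k (+-comm k (n′ * k)))
      n′k+w0≤position-N : n′ * k + w 0 ≤ position N
      n′k+w0≤position-N = +-cancelʳ-≤ (w N) _ _ (begin
        n′ * k + w 0 + w N   ≡⟨ +-assoc (n′ * k) (w 0) (w N) ⟩
        n′ * k + (w 0 + w N) ≡⟨ cong (n′ * k +_) (+-comm (w 0) (w N)) ⟩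
        n′ * k + (w N + w 0) ≤⟨ +-monoʳ-≤ (n′ * k) (subst (λ x → w N + x ≤ k) w-p≡w-0 (w-adjacent N ≤-refl)) ⟩
        n′ * k + k           ≡⟨ +-comm (n′ * k) k ⟩
        n * k                ≡⟨ position-last+w≡n*k ⟨
        position N + w N     ∎)

  edge-windows : ∀ i {a b} → a < w (toℕ i) → b < w (toℕ (nextIdx p i)) →
    (position (toℕ i) + a) % k ≢ (position (toℕ (nextIdx p i)) + b) % k
  edge-windows i with toℕ-nextIdx-cases N i
  ... | inj₁ (i<N , next≡) rewrite next≡ = consecutive-windows (toℕ i) i<N
  ... | inj₂ (i≡N , next≡) rewrite next≡ | i≡N = wrap-windows

  colour : CEVertex p ks → Fin k
  colour (i , a) = (position (toℕ i) + toℕ a) mod k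

  in-window : ∀ {i} (a : Fin (ks i)) → toℕ a < w (toℕ i)
  in-window {i} a = subst (toℕ a <_) (sym (w-toℕ i)) (toℕ<n a)

  mod≡⇒%≡ : ∀ {x y} → x mod k ≡ y mod k → x % k ≡ y % k
  mod≡⇒%≡ e = trans (sym (toℕ-fromℕ< _)) (trans (cong toℕ e) (toℕ-fromℕ< _))

  proper : ProperColoring p ks k colour
  proper (i , a) (j , b) (u≢v , same-or-adjacent) colour≡ with same-or-adjacent
  ... | inj₁ refl = u≢v (cong (i ,_) (toℕ-injective
          (+-%-injective k (position (toℕ i)) (below-k a) (below-k b) (mod≡⇒%≡ colour≡))))
    where
      below-k : (a : Fin (ks i)) → toℕ a < k
      below-k a = <-≤-trans (toℕ<n a) (≤-trans (m≤m+n (ks i) _) (adjacent i))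
  ... | inj₂ (inj₁ refl) = edge-windows i (in-window a) (in-window b) (mod≡⇒%≡ colour≡)
  ... | inj₂ (inj₂ refl) = edge-windows j (in-window b) (in-window a) (sym (mod≡⇒%≡ colour≡))

  colourable : CEColorable p ks k
  colourable = colour , proper

theorem1p4 : (n : ℕ) → 1 ≤ n → (k : ℕ) → 3 ≤ k →
    (ks : Fin (suc (2 * n)) → ℕ) → (∀ i → 1 ≤ ks i) →
    CEColorable (suc (2 * n)) ks k
      ⇔ ((∀ i → ks i + ks (nextIdx (suc (2 * n)) i) ≤ k)
          × sumFin (suc (2 * n)) ks ≤ n * k)
theorem1p4 zero     ()
theorem1p4 (suc n′) _ zero ()
theorem1p4 (suc n′) _ (suc k′) _ ks _ = mk⇔
  (λ (colour , proper) → let open Necessity (nextIdx-≢ _) colour proper in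
      adjacent-clique-sizes-≤
    , subst (_≤ suc n′ * suc k′) (sym (sumFin≡sum _ ks))
        (clique-sizes-∑-≤ (suc n′) (odd-cycle-independent (suc n′))))
  (λ (adjacent , total) →
    Sufficiency.colourable n′ adjacent (subst (_≤ suc n′ * suc k′) (sumFin≡sum _ ks) total))
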